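{- Let $G$ be a connected finite simple graph with an even number of vertices, and let $\mathcal{M}=(M_1,\dots,M_k)$ be a module partition of $G$ such that the module graph $G_{\mathcal{M}}$ is a star. Then $\chi_{\operatorname{odd}}(G)\le 3$.
   Context: A set $S\subseteq V(G)$ is a module if every vertex outside $S$ is adjacent either to all vertices of $S$ or to none of them. A module partition of $G$ is a partition $(M_1,\dots,M_k)$ of $V(G)$ with at least two non-empty parts, each a module. Any two disjoint modules are either complete to each other (all edges present between them) or have no edges between them. The module graph $G_{\mathcal{M}}$ has vertex set the parts of $\mathcal{M}$, with $M_i M_j$ an edge iff $M_i$ and $M_j$ are complete to each other. A graph is odd if every vertex has odd degree (the empty graph counts as odd); $\chi_{\operatorname{odd}}(G)$ is the least $k$ such that $V(G)$ can be partitioned into $k$ (possibly empty) parts each inducing an odd subgraph. -}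

module Defs where

open import Data.Nat using (ℕ; zero; suc; _+_; _*_; _≤_)
open import Data.Fin using (Fin; _≟_)
open import Data.Bool using (Bool; true; false; _∧_)
open import Data.List using (List; length; filter; allFin)
open import Data.Product using (Σ; ∃; _×_; _,_)
open import Data.Sum using (_⊎_)
open import Relation.Binary.PropositionalEquality using (_≡_; _≢_)
open import Relation.Nullary using (¬_)
open import Relation.Nullary.Decidable using (⌊_⌋)

record Graph (n : ℕ) : Set where
  field
    adj    : Fin n → Fin n → Bool
    sym    : ∀ u v → adj u v ≡ adj v u
    irrefl : ∀ v → adj v v ≡ false
open Graph public

data Reach {n : ℕ} (G : Graph n) : Fin n → Fin n → Set where
  here : ∀ {u} → Reach G u u
  step : ∀ {u v w} → adj G u v ≡ true → Reach G v w → Reach G u w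

Connected : ∀ {n} → Graph n → Set
Connected G = ∀ u v → Reach G u v

IsModule : ∀ {n} → Graph n → (Fin n → Bool) → Set
IsModule {n} G S = ∀ x → S x ≡ false →
  ((∀ s → S s ≡ true → adj G x s ≡ true) ⊎ (∀ s → S s ≡ true → adj G x s ≡ false))

Part : ∀ {n k} → (Fin n → Fin k) → Fin k → Fin n → Bool
Part p i v = ⌊ p v ≟ i ⌋

record ModulePartition {n : ℕ} (G : Graph n) (k : ℕ) : Set where
  field
    part     : Fin n → Fin k
    twoParts : 2 ≤ k
    nonempty : ∀ i → ∃ λ v → part v ≡ i
    isModule : ∀ i → IsModule G (Part part i)
open ModulePartition public

Complete : ∀ {n} → Graph n → (Fin n → Bool) → (Fin n → Bool) → Set
Complete G A B = ∀ u v → A u ≡ true → B v ≡ true → adj G u v ≡ true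

-- adjacency in the module graph G_M (for distinct parts i ≠ j)
ModAdj : ∀ {n k} (G : Graph n) → ModulePartition G k → Fin k → Fin k → Set
ModAdj G M i j = Complete G (Part (part M) i) (Part (part M) j)

IsStar : ∀ {n k} (G : Graph n) → ModulePartition G k → Set
IsStar {k = k} G M = Σ (Fin k) λ c → ∀ i j → i ≢ j →
  (ModAdj G M i j → (i ≡ c ⊎ j ≡ c)) × ((i ≡ c ⊎ j ≡ c) → ModAdj G M i j)

Even : ℕ → Set
Even n = ∃ λ m → n ≡ m + m

Odd : ℕ → Set
Odd n = ∃ λ m → n ≡ suc (m + m)

degIn : ∀ {n} → Graph n → (Fin n → Bool) → Fin n → ℕ
degIn {n} G S v = length (filter (λ w → S w ∧ adj G v w ≟B true) (allFin n))
  where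
    open import Data.Bool.Properties renaming (_≟_ to _≟B_)

InducesOdd : ∀ {n} → Graph n → (Fin n → Bool) → Set
InducesOdd G S = ∀ v → S v ≡ true → Odd (degIn G S v)

-- χ_odd(G) ≤ k : V(G) partitions into k (possibly empty) parts each inducing an odd subgraph
OddColourable : ∀ {n} → Graph n → ℕ → Set
OddColourable {n} G k = ∃ λ (c : Fin n → Fin k) → ∀ i → InducesOdd G (Part c i)

module Submission where

-- The centre C of the star is a module complete to every other part, so G is the join of G[C]
-- and G[L] with L the complement of C, and |C| ≡ |L| (mod 2) because n is even. If both are
-- even, an edge {x, y} with x ∈ C and y ∈ L becomes one colour class and leaves sides of odd
-- size. Gallai's theorem splits each remaining side into a part inducing an odd subgraph, which
-- has even size by the handshake lemma, and a part inducing an even subgraph, which therefore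
-- has odd size. The union of the two odd parts and the union of the two even parts are the other
-- two classes: a vertex of C sees all of the matching part of L, whose size has exactly the
-- parity that makes its degree odd.
-- Gallai's even–even splitting is proved by induction on |S|: if a vertex v of S has odd degree,
-- split S − v in the local complement of G at v and put v back into the part in which it has
-- evenly many neighbours. The odd–even version follows by splitting the cone over G.

open import Defs hiding (sym)
open import Algebra.Bundles using (CommutativeRing)
open import Data.Bool using (Bool; true; false; not; _∧_; _xor_; if_then_else_)
open import Data.Bool.Properties
  using ( xor-∧-commutativeRing; ∧-assoc; ∧-comm; ∧-identityʳ; ∧-zeroʳ; ∧-distribˡ-xor
        ; ∧-distribʳ-xor; xor-identityʳ; xor-same; xor-comm; xor-inverseˡ; xor-inverseʳ
        ; not-involutive; ¬-not )
  renaming (_≟_ to _≟ᵇ_)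
open import Data.Fin using (Fin; zero; suc; _≟_)
open import Data.Fin.Properties using (any?)
open import Data.List using (length; filter; tabulate)
open import Data.Nat using (ℕ; zero; suc; _+_; _≤_; s≤s)
open import Data.Nat.Properties using (+-suc; ≤-refl; ≤-pred)
open import Data.Product using (∃; _×_; _,_; proj₁; proj₂)
open import Data.Sum using (inj₁)
open import Data.Vec.Functional using (_∷_)
open import Function using (_∘_; id)
open import Relation.Binary.PropositionalEquality
open import Relation.Nullary using (¬_; Dec; yes; no; does; contradiction)
open import Relation.Nullary.Decidable using (⌊_⌋; _×-dec_; isYes≗does; dec-true; dec-false)
open import Relation.Unary using (Pred; Decidable)

open CommutativeRing xor-∧-commutativeRing using (semiring)
open import Algebra.Properties.Semiring.Sum semiring
  using (sum; sum-cong-≗; ∑-distrib-+; *-distribˡ-sum; sum-replicate-zero)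

private variable n : ℕ

not-true : ∀ {x} → not x ≡ true → x ≡ false
not-true {false} _ = refl

not-false : ∀ {x} → not x ≡ false → x ≡ true
not-false {true} _ = refl

xor≡true⇒≡not : ∀ x {y} → x xor y ≡ true → y ≡ not x
xor≡true⇒≡not false h = h
xor≡true⇒≡not true  h = not-true h

∧-swap : ∀ x y z → x ∧ (y ∧ z) ≡ y ∧ (x ∧ z)
∧-swap x y z = trans (sym (∧-assoc x y z)) (trans (cong (_∧ z) (∧-comm x y)) (∧-assoc y x z))

∧-xor-∧-not : ∀ x y → (x ∧ y) xor (x ∧ not y) ≡ x
∧-xor-∧-not false y     = refl
∧-xor-∧-not true  true  = refl
∧-xor-∧-not true  false = refl

∧-xor-not : ∀ a b → a ∧ (a xor not b) ≡ b ∧ a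
∧-xor-not false b = sym (∧-zeroʳ b)
∧-xor-not true  b = trans (not-involutive b) (sym (∧-identityʳ b))

VertexSet : ℕ → Set
VertexSet n = Fin n → Bool

_∩_ _∖_ : VertexSet n → VertexSet n → VertexSet n
(X ∩ Y) w = X w ∧ Y w
(X ∖ Y) w = X w ∧ not (Y w)

-- Vertex tests use does (w ≟ v) rather than ⌊ w ≟ v ⌋: only the former reduces
-- does (suc w ≟ suc v) to does (w ≟ v), which the inductions over Fin below rely on.
toggleIf : Bool → Fin n → VertexSet n → VertexSet n
toggleIf b v X w = (does (w ≟ v) ∧ b) xor X w

≟-sym : (u w : Fin n) → does (u ≟ w) ≡ does (w ≟ u)
≟-sym u w with u ≟ w
... | yes refl = sym (dec-true (u ≟ u) refl)
... | no  u≢w  = sym (dec-false (w ≟ u) (u≢w ∘ sym))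

-- Sums are taken in the field (Bool, xor, ∧), so sum X is the parity of |X|.
sum-point : (v : Fin n) (f : Fin n → Bool) → sum (λ w → does (w ≟ v) ∧ f w) ≡ f v
sum-point {suc n} zero    f = trans (cong (f zero xor_) (sum-replicate-zero n)) (xor-identityʳ (f zero))
sum-point {suc n} (suc v) f = sum-point v (f ∘ suc)

sum-punctured : (v : Fin n) (f : Fin n → Bool) → sum (λ w → not (does (w ≟ v)) ∧ f w) ≡ f v xor sum f
sum-punctured v f = begin
  sum (λ w → not (does (w ≟ v)) ∧ f w)
    ≡⟨ sum-cong-≗ (λ w → ∧-distribʳ-xor (f w) true (does (w ≟ v))) ⟩
  sum (λ w → (true ∧ f w) xor (does (w ≟ v) ∧ f w))
    ≡⟨ ∑-distrib-+ f _ ⟩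
  sum f xor sum (λ w → does (w ≟ v) ∧ f w)
    ≡⟨ cong (sum f xor_) (sum-point v f) ⟩
  sum f xor f v
    ≡⟨ xor-comm (sum f) (f v) ⟩
  f v xor sum f ∎
  where open ≡-Reasoning

sum-toggleIf : (b : Bool) (v : Fin n) (X : VertexSet n) → sum (toggleIf b v X) ≡ b xor sum X
sum-toggleIf b v X = trans (∑-distrib-+ _ X) (cong (_xor sum X) (sum-point v (λ _ → b)))

sum-split : (X A : VertexSet n) → sum X ≡ sum (X ∩ A) xor sum (X ∖ A)
sum-split X A = sym (trans (sym (∑-distrib-+ (X ∩ A) (X ∖ A))) (sum-cong-≗ λ w → ∧-xor-∧-not (X w) (A w)))

sum-symmetric : (h : Fin n → Fin n → Bool) → (∀ u w → h u w ≡ h w u) → (∀ u → h u u ≡ false) →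
  sum (λ u → sum (h u)) ≡ false
sum-symmetric {zero}  h h-sym h-diag = refl
sum-symmetric {suc n} h h-sym h-diag = begin
  (h zero zero xor r) xor sum (λ u → h (suc u) zero xor sum (h (suc u) ∘ suc))
    ≡⟨ cong₂ (λ d s → (d xor r) xor s) (h-diag zero)
         (∑-distrib-+ (λ u → h (suc u) zero) (λ u → sum (h (suc u) ∘ suc))) ⟩
  r xor (sum (λ u → h (suc u) zero) xor sum (λ u → sum (h (suc u) ∘ suc)))
    ≡⟨ cong₂ (λ c s → r xor (c xor s)) (sum-cong-≗ λ u → h-sym (suc u) zero) (sum-symmetric
         (λ u w → h (suc u) (suc w)) (λ u w → h-sym (suc u) (suc w)) (h-diag ∘ suc)) ⟩
  r xor (r xor false)
    ≡⟨ trans (cong (r xor_) (xor-identityʳ r)) (xor-same r) ⟩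
  false ∎
  where
  open ≡-Reasoning
  r = sum (h zero ∘ suc)

isOdd : ℕ → Bool
isOdd zero    = false
isOdd (suc m) = not (isOdd m)

isOdd-double : ∀ m → isOdd (m + m) ≡ false
isOdd-double zero    = refl
isOdd-double (suc m) = trans (cong (not ∘ isOdd) (+-suc m m)) (trans (not-involutive _) (isOdd-double m))

isOdd⇒Odd  : ∀ m → isOdd m ≡ true → Odd m
isEven⇒Even : ∀ m → isOdd m ≡ false → Even m
isOdd⇒Odd (suc m) h with isEven⇒Even m (not-true h)
... | k , m≡k+k = k , cong suc m≡k+k
isEven⇒Even zero    _ = zero , refl
isEven⇒Even (suc m) h with isOdd⇒Odd m (not-false h)
... | k , m≡1+k+k = suc k , cong suc (trans m≡1+k+k (sym (+-suc k k)))

sum-true : ∀ n → sum {n} (λ _ → true) ≡ isOdd n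
sum-true zero    = refl
sum-true (suc n) = cong not (sum-true n)

sum-true-even : Even n → sum {n} (λ _ → true) ≡ false
sum-true-even (m , refl) = trans (sum-true (m + m)) (isOdd-double m)

isOdd-length-filter : ∀ {a p} {A : Set a} {P : Pred A p} (P? : Decidable P) (g : Fin n → A) →
  isOdd (length (filter P? (tabulate g))) ≡ sum (λ w → does (P? (g w)))
isOdd-length-filter {zero}  P? g = refl
isOdd-length-filter {suc n} P? g with does (P? (g zero))
... | true  = cong not (isOdd-length-filter P? (g ∘ suc))
... | false = isOdd-length-filter P? (g ∘ suc)

does-≟-true : ∀ b → does (b ≟ᵇ true) ≡ b
does-≟-true true  = refl
does-≟-true false = refl

degParity : Graph n → VertexSet n → Fin n → Bool
degParity G K v = sum λ w → K w ∧ adj G v w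

InducesDegreeParity : Graph n → VertexSet n → Bool → Set
InducesDegreeParity G K b = ∀ v → K v ≡ true → degParity G K v ≡ b

degParity-cong : (G : Graph n) {K K′ : VertexSet n} → (∀ w → K w ≡ K′ w) → ∀ v →
  degParity G K v ≡ degParity G K′ v
degParity-cong G K≗K′ v = sum-cong-≗ λ w → cong (_∧ adj G v w) (K≗K′ w)

InducesDegreeParity-cong : (G : Graph n) {K K′ : VertexSet n} {b : Bool} → (∀ w → K w ≡ K′ w) →
  InducesDegreeParity G K b → InducesDegreeParity G K′ b
InducesDegreeParity-cong G K≗K′ K-parity v v∈K′ =
  trans (sym (degParity-cong G K≗K′ v)) (K-parity v (trans (K≗K′ v) v∈K′))

oddDegree : (G : Graph n) (K : VertexSet n) (v : Fin n) → degParity G K v ≡ true → Odd (degIn G K v)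
oddDegree G K v odd = isOdd⇒Odd _ (begin
  isOdd (degIn G K v)                          ≡⟨ isOdd-length-filter (λ w → (K w ∧ adj G v w) ≟ᵇ true) id ⟩
  sum (λ w → does ((K w ∧ adj G v w) ≟ᵇ true)) ≡⟨ sum-cong-≗ (λ w → does-≟-true (K w ∧ adj G v w)) ⟩
  degParity G K v                              ≡⟨ odd ⟩
  true                                         ∎)
  where open ≡-Reasoning

degParity-toggleIf : (G : Graph n) (b : Bool) (v : Fin n) (K : VertexSet n) (u : Fin n) →
  degParity G (toggleIf b v K) u ≡ (b ∧ adj G u v) xor degParity G K u
degParity-toggleIf G b v K u = begin
  sum (λ w → ((does (w ≟ v) ∧ b) xor K w) ∧ adj G u w)
    ≡⟨ sum-cong-≗ (λ w → trans (∧-distribʳ-xor (adj G u w) (does (w ≟ v) ∧ b) (K w))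
                         (cong (_xor (K w ∧ adj G u w)) (∧-assoc (does (w ≟ v)) b (adj G u w)))) ⟩
  sum (λ w → (does (w ≟ v) ∧ (b ∧ adj G u w)) xor (K w ∧ adj G u w))
    ≡⟨ ∑-distrib-+ (λ w → does (w ≟ v) ∧ (b ∧ adj G u w)) (λ w → K w ∧ adj G u w) ⟩
  sum (λ w → does (w ≟ v) ∧ (b ∧ adj G u w)) xor degParity G K u
    ≡⟨ cong (_xor _) (sum-point v (λ w → b ∧ adj G u w)) ⟩
  (b ∧ adj G u v) xor degParity G K u ∎
  where open ≡-Reasoning

degParity-split : (G : Graph n) (K A : VertexSet n) (v : Fin n) →
  degParity G K v ≡ degParity G (K ∩ A) v xor degParity G (K ∖ A) v
degParity-split G K A v = sym (trans (sym (∑-distrib-+ (λ w → (K ∩ A) w ∧ a w) (λ w → (K ∖ A) w ∧ a w)))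
  (sum-cong-≗ λ w → trans (sym (∧-distribʳ-xor (a w) ((K ∩ A) w) ((K ∖ A) w)))
                          (cong (_∧ a w) (∧-xor-∧-not (K w) (A w)))))
  where a = adj G v

degParity-join : (G : Graph n) {P Q : VertexSet n} → (∀ w → Q w ≡ not (P w)) →
  (∀ u w → P u ≡ true → Q w ≡ true → adj G u w ≡ true) →
  (K : VertexSet n) {v : Fin n} → P v ≡ true → degParity G K v ≡ degParity G (P ∩ K) v xor sum (Q ∩ K)
degParity-join G {P} {Q} Q≡¬P complete K {v} v∈P =
  trans (sum-cong-≗ split) (∑-distrib-+ (λ w → (P ∩ K) w ∧ adj G v w) (Q ∩ K))
  where
  split : ∀ w → K w ∧ adj G v w ≡ ((P w ∧ K w) ∧ adj G v w) xor (Q w ∧ K w)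
  split w with P w in eq
  ... | true  rewrite Q≡¬P w | eq = sym (xor-identityʳ _)
  ... | false rewrite complete v w v∈P (trans (Q≡¬P w) (cong not eq)) | Q≡¬P w | eq = ∧-identityʳ (K w)

-- Gallai's theorem

localComplement : Graph n → Fin n → Graph n
localComplement G v = record
  { adj    = λ u w → (not (does (w ≟ u)) ∧ (adj G v u ∧ adj G v w)) xor adj G u w
  ; sym    = λ u w → cong₂ _xor_
      (cong₂ (λ d e → not d ∧ e) (≟-sym w u) (∧-comm (adj G v u) (adj G v w))) (Graph.sym G u w)
  ; irrefl = λ u → trans (cong (λ d → (not d ∧ _) xor adj G u u) (dec-true (u ≟ u) refl)) (Graph.irrefl G u)
  }

degParity-localComplement : (G : Graph n) (v : Fin n) (K : VertexSet n) {u : Fin n} → K u ≡ true →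
  degParity (localComplement G v) K u ≡ (adj G v u ∧ (adj G v u xor degParity G K v)) xor degParity G K u
degParity-localComplement G v K {u} u∈K = begin
  sum (λ w → K w ∧ ((not (does (w ≟ u)) ∧ (a v u ∧ a v w)) xor a u w))
    ≡⟨ sum-cong-≗ (λ w → trans (∧-distribˡ-xor (K w) (not (does (w ≟ u)) ∧ (a v u ∧ a v w)) (a u w))
                               (cong (_xor (K w ∧ a u w)) (rearrange w))) ⟩
  sum (λ w → (a v u ∧ (not (does (w ≟ u)) ∧ (K w ∧ a v w))) xor (K w ∧ a u w))
    ≡⟨ ∑-distrib-+ (λ w → a v u ∧ (not (does (w ≟ u)) ∧ (K w ∧ a v w))) (λ w → K w ∧ a u w) ⟩
  sum (λ w → a v u ∧ (not (does (w ≟ u)) ∧ (K w ∧ a v w))) xor degParity G K u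
    ≡⟨ cong (_xor degParity G K u) (sym (*-distribˡ-sum (a v u) (λ w → not (does (w ≟ u)) ∧ (K w ∧ a v w)))) ⟩
  (a v u ∧ sum (λ w → not (does (w ≟ u)) ∧ (K w ∧ a v w))) xor degParity G K u
    ≡⟨ cong (λ s → (a v u ∧ s) xor degParity G K u) (sum-punctured u (λ w → K w ∧ a v w)) ⟩
  (a v u ∧ ((K u ∧ a v u) xor degParity G K v)) xor degParity G K u
    ≡⟨ cong (λ k → (a v u ∧ ((k ∧ a v u) xor degParity G K v)) xor degParity G K u) u∈K ⟩
  (a v u ∧ (a v u xor degParity G K v)) xor degParity G K u ∎
  where
  open ≡-Reasoning
  a = adj G
  rearrange : ∀ w → K w ∧ (not (does (w ≟ u)) ∧ (a v u ∧ a v w))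
                  ≡ a v u ∧ (not (does (w ≟ u)) ∧ (K w ∧ a v w))
  rearrange w = trans (∧-swap (K w) d (a v u ∧ a v w)) (trans (cong (d ∧_) (∧-swap (K w) (a v u) (a v w)))
                  (∧-swap d (a v u) (K w ∧ a v w)))
    where d = not (does (w ≟ u))

evenDegrees-reinsert : (G : Graph n) (v : Fin n) (K : VertexSet n) (b : Bool) →
  degParity G K v ≡ not b → K v ≡ false →
  InducesDegreeParity (localComplement G v) K false → InducesDegreeParity G (toggleIf b v K) false
evenDegrees-reinsert G v K b K-v v∉K K-even u u∈ with u ≟ v
... | yes refl rewrite degParity-toggleIf G b u K u | Graph.irrefl G u | K-v | ∧-zeroʳ b = cong not b≡true
  where
  b≡true : b ≡ true
  b≡true = trans (sym (xor-identityʳ b)) (trans (cong (b xor_) (sym v∉K)) u∈)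
... | no u≢v = begin
  degParity G (toggleIf b v K) u                                    ≡⟨ degParity-toggleIf G b v K u ⟩
  (b ∧ adj G u v) xor degParity G K u                               ≡⟨ cong (_xor degParity G K u) bridge ⟩
  (adj G v u ∧ (adj G v u xor degParity G K v)) xor degParity G K u ≡⟨ degParity-localComplement G v K u∈ ⟨
  degParity (localComplement G v) K u                               ≡⟨ K-even u u∈ ⟩
  false                                                             ∎
  where
  open ≡-Reasoning
  bridge : b ∧ adj G u v ≡ adj G v u ∧ (adj G v u xor degParity G K v)
  bridge = trans (cong (b ∧_) (Graph.sym G u v))
    (sym (trans (cong (λ t → adj G v u ∧ (adj G v u xor t)) K-v) (∧-xor-not (adj G v u) b)))

IsEvenSplit : Graph n → VertexSet n → VertexSet n → Set
IsEvenSplit G S A = InducesDegreeParity G (S ∩ A) false × InducesDegreeParity G (S ∖ A) false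

∧-if : (f : Bool → Bool) (s d c x : Bool) → (d ≡ true → s ≡ true) →
  s ∧ f (if d then c else x) ≡ (d ∧ f c) xor (((d ∧ true) xor s) ∧ f x)
∧-if f s false c x _   = refl
∧-if f s true  c x d→s rewrite d→s refl = sym (xor-identityʳ (f c))

evenSplit-localComplement : (G : Graph n) (S : VertexSet n) (v : Fin n) →
  S v ≡ true → degParity G S v ≡ true →
  ∀ {A′} → IsEvenSplit (localComplement G v) (toggleIf true v S) A′ → ∃ (IsEvenSplit G S)
evenSplit-localComplement G S v v∈S v-odd {A′} (∩-even , ∖-even) = A , ∩-even′ , ∖-even′
  where
  S′ = toggleIf true v S
  t = degParity G (S′ ∩ A′) v

  -- v joins the part in which it has evenly many neighbours: t for S′ ∩ A′, and not t for
  -- S′ ∖ A′ since its degree in S′ is odd.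
  A : VertexSet _
  A w = if does (w ≟ v) then not t else A′ w

  v∉S′ : S′ v ≡ false
  v∉S′ = trans (cong (λ d → (d ∧ true) xor S v) (dec-true (v ≟ v) refl)) (cong not v∈S)

  t′≡¬t : degParity G (S′ ∖ A′) v ≡ not t
  t′≡¬t = xor≡true⇒≡not t (begin
    t xor degParity G (S′ ∖ A′) v ≡⟨ degParity-split G S′ A′ v ⟨
    degParity G S′ v              ≡⟨ degParity-toggleIf G true v S v ⟩
    adj G v v xor degParity G S v ≡⟨ cong₂ _xor_ (Graph.irrefl G v) v-odd ⟩
    true                          ∎)
    where open ≡-Reasoning

  member : ∀ w → does (w ≟ v) ≡ true → S w ≡ true
  member w w≡v with w ≟ v
  ... | yes refl = v∈S

  ∩-even′ : InducesDegreeParity G (S ∩ A) false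
  ∩-even′ = InducesDegreeParity-cong G (λ w → sym (∧-if id (S w) (does (w ≟ v)) (not t) (A′ w) (member w)))
    (evenDegrees-reinsert G v (S′ ∩ A′) (not t) (sym (not-involutive t)) (cong (_∧ A′ v) v∉S′) ∩-even)

  ∖-even′ : InducesDegreeParity G (S ∖ A) false
  ∖-even′ = InducesDegreeParity-cong G (λ w → sym (∧-if not (S w) (does (w ≟ v)) (not t) (A′ w) (member w)))
    (evenDegrees-reinsert G v (S′ ∖ A′) (not (not t)) (trans t′≡¬t (sym (not-involutive (not t))))
      (cong (_∧ not (A′ v)) v∉S′) ∖-even)

size : VertexSet n → ℕ
size {zero}  X = 0
size {suc n} X = (if X zero then 1 else 0) + size (X ∘ suc)

size-toggleIf : (X : VertexSet n) {v : Fin n} → X v ≡ true → size X ≡ suc (size (toggleIf true v X))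
size-toggleIf {suc n} X {zero}  X₀ rewrite X₀ = refl
size-toggleIf {suc n} X {suc v} Xv = trans (cong (c +_) (size-toggleIf (X ∘ suc) Xv)) (+-suc c _)
  where c = if X zero then 1 else 0

evenSplit-bounded : ∀ m (G : Graph n) (S : VertexSet n) → size S ≤ m → ∃ (IsEvenSplit G S)
evenSplit-bounded m G S |S|≤m with any? (λ v → (S v ≟ᵇ true) ×-dec (degParity G S v ≟ᵇ true))
... | no no-odd = (λ _ → true) , all-even , none
  where
  all-even : InducesDegreeParity G (S ∩ (λ _ → true)) false
  all-even = InducesDegreeParity-cong G (λ w → sym (∧-identityʳ (S w)))
    (λ v v∈S → ¬-not (λ v-odd → no-odd (v , v∈S , v-odd)))
  none : InducesDegreeParity G (S ∖ (λ _ → true)) false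
  none v v∈ = contradiction (trans (sym (∧-zeroʳ (S v))) v∈) λ ()
evenSplit-bounded zero    G S |S|≤0 | yes (v , v∈S , _) =
  contradiction (subst (_≤ 0) (size-toggleIf S v∈S) |S|≤0) λ ()
evenSplit-bounded (suc m) G S |S|≤m | yes (v , v∈S , v-odd) =
  evenSplit-localComplement G S v v∈S v-odd
    (proj₂ (evenSplit-bounded m (localComplement G v) (toggleIf true v S)
      (≤-pred (subst (_≤ suc m) (size-toggleIf S v∈S) |S|≤m))))

evenSplit : (G : Graph n) (S : VertexSet n) → ∃ (IsEvenSplit G S)
evenSplit G S = evenSplit-bounded (size S) G S ≤-refl

evenSplit-containing : (G : Graph n) (S : VertexSet n) (r : Fin n) → ∃ λ A → A r ≡ true × IsEvenSplit G S A
evenSplit-containing G S r with evenSplit G S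
... | A , ∩-even , ∖-even with A r in r∈A
...   | true  = A , r∈A , ∩-even , ∖-even
...   | false = not ∘ A , cong not r∈A , ∖-even ,
                InducesDegreeParity-cong G (λ w → cong (S w ∧_) (sym (not-involutive (A w)))) ∩-even

cone : Graph n → Graph (suc n)
cone {n} G = record { adj = a ; sym = a-sym ; irrefl = a-irrefl }
  where
  a : Fin (suc n) → Fin (suc n) → Bool
  a zero    zero    = false
  a zero    (suc _) = true
  a (suc _) zero    = true
  a (suc u) (suc w) = adj G u w
  a-sym : ∀ u w → a u w ≡ a w u
  a-sym zero    zero    = refl
  a-sym zero    (suc _) = refl
  a-sym (suc _) zero    = refl
  a-sym (suc u) (suc w) = Graph.sym G u w
  a-irrefl : ∀ u → a u u ≡ false
  a-irrefl zero    = refl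
  a-irrefl (suc u) = Graph.irrefl G u

-- The apex lies in A, so it adds one neighbour to every vertex of S ∩ A and none to the
-- vertices of S ∖ A.
oddEvenSplit : (G : Graph n) (S : VertexSet n) →
  ∃ λ A → InducesDegreeParity G (S ∩ A) true × InducesDegreeParity G (S ∖ A) false
oddEvenSplit G S with evenSplit-containing (cone G) (true ∷ S) zero
... | A⁺ , apex∈A⁺ , ∩-even , ∖-even = A⁺ ∘ suc , ∩-odd , ∖-even′
  where
  ∩-odd : InducesDegreeParity G (S ∩ (A⁺ ∘ suc)) true
  ∩-odd u u∈ = not-false (subst (λ a → (a ∧ true) xor degParity G (S ∩ (A⁺ ∘ suc)) u ≡ false)
    apex∈A⁺ (∩-even (suc u) u∈))
  ∖-even′ : InducesDegreeParity G (S ∖ (A⁺ ∘ suc)) false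
  ∖-even′ u u∈ = subst (λ a → (not a ∧ true) xor degParity G (S ∖ (A⁺ ∘ suc)) u ≡ false)
    apex∈A⁺ (∖-even (suc u) u∈)

sum-oddDegrees : (G : Graph n) (K : VertexSet n) → InducesDegreeParity G K true → sum K ≡ false
sum-oddDegrees G K K-odd = begin
  sum K
    ≡⟨ sum-cong-≗ pad ⟩
  sum (λ u → K u ∧ degParity G K u)
    ≡⟨ sum-cong-≗ (λ u → *-distribˡ-sum (K u) (λ w → K w ∧ adj G u w)) ⟩
  sum (λ u → sum (λ w → K u ∧ (K w ∧ adj G u w)))
    ≡⟨ sum-symmetric (λ u w → K u ∧ (K w ∧ adj G u w)) h-sym h-diag ⟩
  false ∎
  where
  open ≡-Reasoning
  pad : ∀ u → K u ≡ K u ∧ degParity G K u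
  pad u with K u in u∈K
  ... | true  = sym (K-odd u u∈K)
  ... | false = refl
  h-sym : ∀ u w → K u ∧ (K w ∧ adj G u w) ≡ K w ∧ (K u ∧ adj G w u)
  h-sym u w = trans (∧-swap (K u) (K w) (adj G u w)) (cong (λ x → K w ∧ (K u ∧ x)) (Graph.sym G u w))
  h-diag : ∀ u → K u ∧ (K u ∧ adj G u u) ≡ false
  h-diag u = trans (cong (λ x → K u ∧ (K u ∧ x)) (Graph.irrefl G u))
                   (trans (cong (K u ∧_) (∧-zeroʳ (K u))) (∧-zeroʳ (K u)))

-- Odd colourings of joins

point-degreeParity : (G : Graph n) (z : Fin n) (e : Bool) →
  InducesDegreeParity G (λ w → does (w ≟ z) ∧ e) (not e)
point-degreeParity G z e v v∈ with v ≟ z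
... | yes refl = trans (sum-cong-≗ λ w → ∧-assoc (does (w ≟ v)) e (adj G v w))
  (trans (sum-point v (λ w → e ∧ adj G v w))
         (subst (λ x → x ∧ adj G v v ≡ not x) (sym v∈) (Graph.irrefl G v)))

colourOf : Bool → Bool → Fin 3
colourOf true  _     = suc (suc zero)
colourOf false true  = zero
colourOf false false = suc zero

colourOf-zero : ∀ p r a → (r ≡ true → p ≡ true) → p ∧ ⌊ colourOf r a ≟ zero ⌋ ≡ (r xor p) ∧ a
colourOf-zero p     false true  _   = refl
colourOf-zero p     false false _   = refl
colourOf-zero true  true  a     _   = refl
colourOf-zero false true  a     r→p = contradiction (r→p refl) λ ()

colourOf-one : ∀ p r a → (r ≡ true → p ≡ true) → p ∧ ⌊ colourOf r a ≟ suc zero ⌋ ≡ (r xor p) ∧ not a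
colourOf-one p     false true  _   = refl
colourOf-one p     false false _   = refl
colourOf-one true  true  a     _   = refl
colourOf-one false true  a     r→p = contradiction (r→p refl) λ ()

colourOf-two : ∀ p r a → (r ≡ true → p ≡ true) → p ∧ ⌊ colourOf r a ≟ suc (suc zero) ⌋ ≡ r
colourOf-two p     false true  _   = ∧-zeroʳ p
colourOf-two p     false false _   = ∧-zeroʳ p
colourOf-two true  true  a     _   = refl
colourOf-two false true  a     r→p = contradiction (r→p refl) λ ()

classParity : Bool → Fin 3 → Bool
classParity e zero             = false
classParity e (suc zero)       = true
classParity e (suc (suc zero)) = e

-- A vertex of class i on one side of a join sees all of class i on the other side; the two
-- parities below add up to an odd degree.
record SideColouring (G : Graph n) (P : VertexSet n) (e : Bool) : Set where
  field
    colour       : Fin n → Fin 3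
    class-size   : ∀ i → sum (P ∩ Part colour i) ≡ classParity e i
    class-degree : ∀ i → InducesDegreeParity G (P ∩ Part colour i) (not (classParity e i))

sideColouring : (G : Graph n) (P : VertexSet n) {z : Fin n} → P z ≡ true →
  (e : Bool) → sum P ≡ not e → SideColouring G P e
sideColouring G P {z} z∈P e |P| = record
  { colour = colour ; class-size = class-size ; class-degree = class-degree }
  where
  -- R is {z} when |P| is even, so that S = P ∖ R has odd size.
  R : VertexSet _
  R w = does (w ≟ z) ∧ e
  S = toggleIf e z P
  split = oddEvenSplit G S
  A = proj₁ split
  ∩-odd = proj₁ (proj₂ split)
  ∖-even = proj₂ (proj₂ split)

  colour : Fin _ → Fin 3
  colour w = colourOf (R w) (A w)

  R⊆P : ∀ w → R w ≡ true → P w ≡ true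
  R⊆P w w∈R with w ≟ z
  ... | yes refl = z∈P

  |S| : sum S ≡ true
  |S| = trans (sum-toggleIf e z P) (trans (cong (e xor_) |P|) (xor-inverseʳ e))

  |S∖A| : sum (S ∖ A) ≡ true
  |S∖A| = trans (cong (_xor sum (S ∖ A)) (sym (sum-oddDegrees G (S ∩ A) ∩-odd)))
            (trans (sym (sum-split S A)) |S|)

  class-size : ∀ i → sum (P ∩ Part colour i) ≡ classParity e i
  class-size zero = trans (sum-cong-≗ λ w → colourOf-zero (P w) (R w) (A w) (R⊆P w))
    (sum-oddDegrees G (S ∩ A) ∩-odd)
  class-size (suc zero) = trans (sum-cong-≗ λ w → colourOf-one (P w) (R w) (A w) (R⊆P w)) |S∖A|
  class-size (suc (suc zero)) = trans (sum-cong-≗ λ w → colourOf-two (P w) (R w) (A w) (R⊆P w))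
    (sum-point z (λ _ → e))

  class-degree : ∀ i → InducesDegreeParity G (P ∩ Part colour i) (not (classParity e i))
  class-degree zero =
    InducesDegreeParity-cong G (λ w → sym (colourOf-zero (P w) (R w) (A w) (R⊆P w))) ∩-odd
  class-degree (suc zero) =
    InducesDegreeParity-cong G (λ w → sym (colourOf-one (P w) (R w) (A w) (R⊆P w))) ∖-even
  class-degree (suc (suc zero)) =
    InducesDegreeParity-cong G (λ w → sym (colourOf-two (P w) (R w) (A w) (R⊆P w))) (point-degreeParity G z e)

∩-Part-agree : ∀ {k} (P : VertexSet n) {c c′ : Fin n → Fin k} → (∀ w → P w ≡ true → c w ≡ c′ w) →
  ∀ i w → (P ∩ Part c i) w ≡ (P ∩ Part c′ i) w
∩-Part-agree P agree i w with P w in w∈P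
... | true  = cong (λ j → ⌊ j ≟ i ⌋) (agree w w∈P)
... | false = refl

join-degreeParity : (G : Graph n) {P Q : VertexSet n} {e : Bool} → (∀ w → Q w ≡ not (P w)) →
  (∀ u w → P u ≡ true → Q w ≡ true → adj G u w ≡ true) →
  (cP : SideColouring G P e) (cQ : SideColouring G Q e) (c : Fin n → Fin 3) →
  (∀ w → P w ≡ true → c w ≡ SideColouring.colour cP w) →
  (∀ w → Q w ≡ true → c w ≡ SideColouring.colour cQ w) →
  ∀ i v → P v ≡ true → Part c i v ≡ true → degParity G (Part c i) v ≡ true
join-degreeParity G {P} {Q} {e} Q≡¬P complete cP cQ c on-P on-Q i v v∈P v∈i = begin
  degParity G (Part c i) v
    ≡⟨ degParity-join G Q≡¬P complete (Part c i) v∈P ⟩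
  degParity G (P ∩ Part c i) v xor sum (Q ∩ Part c i)
    ≡⟨ cong₂ _xor_ (degParity-cong G (∩-Part-agree P on-P i) v) (sum-cong-≗ (∩-Part-agree Q on-Q i)) ⟩
  degParity G (P ∩ Part (colour cP) i) v xor sum (Q ∩ Part (colour cQ) i)
    ≡⟨ cong₂ _xor_ (class-degree cP i v v∈Pᵢ) (class-size cQ i) ⟩
  not (classParity e i) xor classParity e i
    ≡⟨ xor-inverseˡ (classParity e i) ⟩
  true ∎
  where
  open ≡-Reasoning
  open SideColouring
  v∈Pᵢ = trans (sym (∩-Part-agree P on-P i v)) (cong₂ _∧_ v∈P v∈i)

sideColourings⇒oddColourable : (G : Graph n) (C : VertexSet n) {e : Bool} →
  (∀ u w → C u ≡ true → C w ≡ false → adj G u w ≡ true) →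
  SideColouring G C e → SideColouring G (not ∘ C) e → OddColourable G 3
sideColourings⇒oddColourable G C complete cC cL = c , λ i v v∈i → oddDegree G (Part c i) v (degree i v v∈i)
  where
  open SideColouring
  c : Fin _ → Fin 3
  c w = if C w then colour cC w else colour cL w
  on-C : ∀ w → C w ≡ true → c w ≡ colour cC w
  on-C w w∈C = cong (λ b → if b then colour cC w else colour cL w) w∈C
  on-L : ∀ w → not (C w) ≡ true → c w ≡ colour cL w
  on-L w w∈L = cong (λ b → if b then colour cC w else colour cL w) (not-true w∈L)
  degree : ∀ i v → Part c i v ≡ true → degParity G (Part c i) v ≡ true
  degree i v v∈i with C v ≟ᵇ true
  ... | yes v∈C = join-degreeParity G (λ _ → refl)
    (λ u w u∈C w∈L → complete u w u∈C (not-true w∈L)) cC cL c on-C on-L i v v∈C v∈i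
  ... | no  v∉C = join-degreeParity G (λ w → sym (not-involutive (C w)))
    (λ u w u∈L w∈C → trans (Graph.sym G u w) (complete w u w∈C (not-true u∈L))) cL cC c on-L on-C i v
    (cong not (¬-not v∉C)) v∈i

oddColourable-join : (G : Graph n) → Even n → (C : VertexSet n) {x y : Fin n} → C x ≡ true → C y ≡ false →
  (∀ u w → C u ≡ true → C w ≡ false → adj G u w ≡ true) → OddColourable G 3
oddColourable-join G even C x∈C y∉C complete = sideColourings⇒oddColourable G C complete
  (sideColouring G C x∈C (not (sum C)) (sym (not-involutive (sum C))))
  (sideColouring G (not ∘ C) (cong not y∉C) (not (sum C)) |L|)
  where
  |L| : sum (not ∘ C) ≡ not (not (sum C))
  |L| = trans (∑-distrib-+ (λ _ → true) C)
    (trans (cong (_xor sum C) (sum-true-even even)) (sym (not-involutive (sum C))))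

⌊⌋-yes : ∀ {a} {A : Set a} (a? : Dec A) → A → ⌊ a? ⌋ ≡ true
⌊⌋-yes a? x = trans (isYes≗does a?) (dec-true a? x)

⌊⌋-no : ∀ {a} {A : Set a} (a? : Dec A) → ¬ A → ⌊ a? ⌋ ≡ false
⌊⌋-no a? ¬x = trans (isYes≗does a?) (dec-false a? ¬x)

∃-≢ : ∀ {k} → 2 ≤ k → (c : Fin k) → ∃ λ j → ¬ j ≡ c
∃-≢ (s≤s (s≤s _)) zero    = suc zero , λ ()
∃-≢ (s≤s (s≤s _)) (suc _) = zero , λ ()

lemma16 : (n : ℕ) (G : Graph n) → Connected G → Even n →
    (k : ℕ) (M : ModulePartition G k) → IsStar G M →
    OddColourable G 3
lemma16 n G _ even k M (c , star) = oddColourable-join G even centre x∈centre y∉centre complete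
  where
  centre = Part (part M) c
  x = proj₁ (nonempty M c)
  x∈centre = ⌊⌋-yes (part M x ≟ c) (proj₂ (nonempty M c))
  j = proj₁ (∃-≢ (twoParts M) c)
  y = proj₁ (nonempty M j)
  y∉centre = ⌊⌋-no (part M y ≟ c) λ y∈c →
    proj₂ (∃-≢ (twoParts M) c) (trans (sym (proj₂ (nonempty M j))) y∈c)
  complete : ∀ u w → centre u ≡ true → centre w ≡ false → adj G u w ≡ true
  complete u w u∈c w∉c =
    proj₂ (star c (part M w) c≢w) (inj₁ refl) u w u∈c (⌊⌋-yes (part M w ≟ part M w) refl)
    where c≢w = λ c≡w → contradiction (trans (sym (⌊⌋-yes (part M w ≟ c) (sym c≡w))) w∉c) λ ()
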